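{- Let $G$ be a skeletal triangulation and let $u,v$ be vertices of $G$, each involved in a low-degree problem that is not a degree-2 cut vertex — that is, each of $u,v$ is a degree-3 vertex in a 3-pair of a bad 5-wheel, or a degree-2 vertex in an ear, pivoting triangle or isolated triangle — where the low-degree problem of $u$ is distinct from that of $v$. Then $u$ is not adjacent to $v$.
   Context: A skeletal triangulation is a connected plane graph in which every bounded face is a triangle and every vertex has degree at least $2$; boundary vertices lie on the unbounded face. A facial triangle bounds a bounded face. An ear is a facial triangle with exactly one vertex of degree $2$; a pivoting triangle is a facial triangle with exactly two vertices of degree $2$; an isolated triangle is a facial triangle all three of whose vertices have degree $2$. A bad 5-wheel is a subgraph isomorphic to the 5-wheel (a 4-cycle plus a center adjacent to all four) whose 4-cycle contains two consecutive vertices that are both boundary vertices of $G$ of degree $3$; such a pair is a 3-pair. Low-degree problems are ears, pivoting triangles, isolated triangles, degree-2 cut vertices and bad 5-wheels. -}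

module Defs where

-- Plane graphs are represented combinatorially by rotation systems
-- (combinatorial maps): darts Fin D, a fixed-point-free involution α
-- (the two darts of an edge), a rotation σ around each vertex, and
-- face permutation φ = σ ∘ α.  Connected maps with V + F = E + 2
-- (Euler's formula) are exactly the combinatorial embeddings of
-- connected plane graphs.  One dart `outer` marks the unbounded face.

open import Data.Nat using (ℕ; zero; suc; _+_; _*_; _≤ᵇ_; _≡ᵇ_)
open import Data.Bool using (Bool; true; false; if_then_else_)
open import Data.Fin using (Fin; toℕ; _≟_)
open import Data.List using (List; map; upTo)
open import Data.Bool.ListAction using () renaming (all to allL)
open import Data.Nat.ListAction using (sum)
open import Data.List using () renaming (allFin to allFinL)
open import Data.Product using (Σ; ∃; _×_; _,_)
open import Data.Sum using (_⊎_)
open import Data.Empty using (⊥)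
open import Relation.Nullary using (¬_; ⌊_⌋)
open import Relation.Binary.PropositionalEquality using (_≡_; _≢_)
open import Relation.Binary.Construct.Closure.ReflexiveTransitive using (Star)
open import Function using (_∘_; Injective)

iter : {A : Set} → (A → A) → ℕ → A → A
iter f zero x = x
iter f (suc k) x = f (iter f k x)

-- number of orbits of f on Fin D (count darts minimal in their orbit)
isOrbitRep : {D : ℕ} → (Fin D → Fin D) → Fin D → Bool
isOrbitRep {D} f x = allL (λ k → toℕ x ≤ᵇ toℕ (iter f k x)) (upTo D)

orbitCount : {D : ℕ} → (Fin D → Fin D) → ℕ
orbitCount {D} f = sum (map (λ x → if isOrbitRep f x then 1 else 0) (allFinL D))

record PlaneGraph : Set where
  field
    V D : ℕ
    vert : Fin D → Fin V               -- tail vertex of a dart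
    α σ : Fin D → Fin D
    α-invol : ∀ x → α (α x) ≡ x
    α-nofix : ∀ x → α x ≢ x
    σ-inj : Injective _≡_ _≡_ σ
    σ-vert : ∀ x → vert (σ x) ≡ vert x
    σ-trans : ∀ x y → vert x ≡ vert y → ∃ λ k → iter σ k x ≡ y
    vert-surj : ∀ v → ∃ λ x → vert x ≡ v
    no-loop : ∀ x → vert (α x) ≢ vert x
    no-multi : ∀ x y → vert x ≡ vert y → vert (α x) ≡ vert (α y) → x ≡ y
    outer : Fin D

  φ : Fin D → Fin D
  φ = σ ∘ α

  F : ℕ
  F = orbitCount φ

  Adj : Fin V → Fin V → Set
  Adj u v = ∃ λ x → vert x ≡ u × vert (α x) ≡ v

  Connected : Set
  Connected = ∀ u v → Star Adj u v

  -- Euler's formula V - E + F = 2 with E = D/2 (genus 0)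
  Planar : Set
  Planar = 2 * (V + F) ≡ D + 4

  deg : Fin V → ℕ
  deg v = sum (map (λ x → if ⌊ vert x ≟ v ⌋ then 1 else 0) (allFinL D))

  SameFace : Fin D → Fin D → Set
  SameFace x y = ∃ λ k → iter φ k x ≡ y

  BoundaryVertex : Fin V → Set
  BoundaryVertex v = ∃ λ k → vert (iter φ k outer) ≡ v

  FacialTriangle : Fin D → Set
  FacialTriangle x = ¬ SameFace outer x × iter φ 3 x ≡ x × φ x ≢ x

  OnTriangle : Fin V → Fin D → Set
  OnTriangle u x = vert x ≡ u ⊎ vert (φ x) ≡ u ⊎ vert (φ (φ x)) ≡ u

  d2 : Fin V → ℕ
  d2 w = if deg w ≡ᵇ 2 then 1 else 0

  numDeg2 : Fin D → ℕ
  numDeg2 x = d2 (vert x) + d2 (vert (φ x)) + d2 (vert (φ (φ x)))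

  Ear Pivoting Isolated : Fin D → Set
  Ear x = FacialTriangle x × numDeg2 x ≡ 1
  Pivoting x = FacialTriangle x × numDeg2 x ≡ 2
  Isolated x = FacialTriangle x × numDeg2 x ≡ 3

  -- a 5-wheel: center c, rim 4-cycle a1 a2 a3 a4
  record Wheel : Set where
    eta-equality
    constructor wheel
    field c a1 a2 a3 a4 : Fin V

  WEdge₀ : Wheel → Fin V → Fin V → Set
  WEdge₀ (wheel c a1 a2 a3 a4) x y =
    (x ≡ c × y ≡ a1) ⊎ (x ≡ c × y ≡ a2) ⊎ (x ≡ c × y ≡ a3) ⊎ (x ≡ c × y ≡ a4) ⊎
    (x ≡ a1 × y ≡ a2) ⊎ (x ≡ a2 × y ≡ a3) ⊎ (x ≡ a3 × y ≡ a4) ⊎ (x ≡ a4 × y ≡ a1)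

  WEdge : Wheel → Fin V → Fin V → Set
  WEdge w x y = WEdge₀ w x y ⊎ WEdge₀ w y x

  IsWheel : Wheel → Set
  IsWheel w@(wheel c a1 a2 a3 a4) =
    (c ≢ a1 × c ≢ a2 × c ≢ a3 × c ≢ a4 × a1 ≢ a2 × a1 ≢ a3 × a1 ≢ a4 ×
     a2 ≢ a3 × a2 ≢ a4 × a3 ≢ a4) ×
    (∀ x y → WEdge₀ w x y → Adj x y)

  ThreePair : Fin V → Fin V → Set
  ThreePair a b = BoundaryVertex a × deg a ≡ 3 × BoundaryVertex b × deg b ≡ 3

  InThreePair : Fin V → Wheel → Set
  InThreePair u (wheel c a1 a2 a3 a4) =
    (ThreePair a1 a2 × (u ≡ a1 ⊎ u ≡ a2)) ⊎ (ThreePair a2 a3 × (u ≡ a2 ⊎ u ≡ a3)) ⊎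
    (ThreePair a3 a4 × (u ≡ a3 ⊎ u ≡ a4)) ⊎ (ThreePair a4 a1 × (u ≡ a4 ⊎ u ≡ a1))

  -- low-degree problems other than degree-2 cut vertices
  data Problem : Set where
    triangle : Fin D → Problem      -- the bounded face containing this dart
    bad5wheel : Wheel → Problem

  InvolvedIn : Fin V → Problem → Set
  InvolvedIn u (triangle x) = (Ear x ⊎ Pivoting x ⊎ Isolated x) × OnTriangle u x × deg u ≡ 2
  InvolvedIn u (bad5wheel w) = IsWheel w × InThreePair u w

  SameProblem : Problem → Problem → Set
  SameProblem (triangle x) (triangle y) = SameFace x y
  SameProblem (bad5wheel w) (bad5wheel w') = ∀ x y → (WEdge w x y → WEdge w' x y) × (WEdge w' x y → WEdge w x y)
  SameProblem (triangle _) (bad5wheel _) = ⊥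
  SameProblem (bad5wheel _) (triangle _) = ⊥

  Skeletal : Set
  Skeletal = Connected × Planar ×
             (∀ x → ¬ SameFace outer x → iter φ 3 x ≡ x × φ x ≢ x) ×
             (∀ v → 2 Data.Nat.≤ deg v)

module Submission where

-- A degree-2 corner of a facial triangle is adjacent only to the two other corners, so two
-- adjacent degree-2 vertices u, v on bounded triangles x and y span an edge of x.  If y is
-- not x, its corner at v is the other dart at v, which lies on the face running backwards
-- around x; that face being a triangle forces all three corners of x to have degree 2, and
-- then by connectivity the six darts of x and its reverse are all darts, so one of the two
-- faces is the outer one.  A degree-3 rim vertex of a wheel is adjacent only to the hub and
-- its two rim neighbours, each of which has three neighbours inside the wheel, so it has no
-- degree-2 neighbour; and two adjacent degree-3 rim vertices pin down the hub and the whole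
-- rim of both wheels, which are therefore equal up to rotation and reflection.

open import Defs
open import Algebra.Properties.CommutativeSemigroup using (x∙yz≈y∙xz)
open import Data.Bool using (if_then_else_)
open import Data.Empty using (⊥; ⊥-elim)
open import Data.Fin using (Fin; _≟_)
open import Data.List using (List; []; _∷_; length; map)
open import Data.List.Membership.Propositional using (_∈_)
open import Data.List.Membership.Propositional.Properties using (∈-allFin)
open import Data.List.Relation.Unary.All as All using (All; []; _∷_)
open import Data.List.Relation.Unary.AllPairs using (AllPairs; []; _∷_)
open import Data.List.Relation.Unary.Any using (here; there; _─_)
open import Data.Nat using (ℕ; zero; suc; _+_; _≤_; s≤s; z≤n)
open import Data.Nat.ListAction using (sum)
open import Data.Nat.Properties using (1+n≰n; +-commutativeSemigroup)
open import Data.Product using (∃; _×_; _,_; proj₁; proj₂; swap)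
open import Data.Sum as Sum using (_⊎_; inj₁; inj₂)
open import Function using (_∘_)
open import Relation.Binary.Construct.Closure.ReflexiveTransitive using (Star; ε; _◅_)
open import Relation.Binary.PropositionalEquality
open import Relation.Nullary using (¬_; yes; no; ⌊_⌋)

open PlaneGraph using (triangle; bad5wheel)

∈-─⁺ : ∀ {A : Set} {z e : A} {xs} → z ∈ xs → z ≢ e → (m : e ∈ xs) → z ∈ (xs ─ m)
∈-─⁺ (here refl) z≢e (here refl) = ⊥-elim (z≢e refl)
∈-─⁺ (there z∈xs) _ (here refl) = z∈xs
∈-─⁺ (here refl) _ (there _) = here refl
∈-─⁺ (there z∈xs) z≢e (there m) = there (∈-─⁺ z∈xs z≢e m)

iter-+ : ∀ {A : Set} (f : A → A) m n x → iter f (m + n) x ≡ iter f m (iter f n x)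
iter-+ f zero n x = refl
iter-+ f (suc m) n x = cong f (iter-+ f m n x)

iter-fixed : ∀ {A : Set} (f : A → A) {x} k → f x ≡ x → iter f k x ≡ x
iter-fixed f zero fx≡x = refl
iter-fixed f (suc k) fx≡x = trans (cong f (iter-fixed f k fx≡x)) fx≡x

module _ (G : PlaneGraph) where
  open PlaneGraph G

  Adj-sym : ∀ {u v} → Adj u v → Adj v u
  Adj-sym (e , e-at , e-to) = α e , e-to , trans (cong vert (α-invol e)) e-at

  vert-φ : ∀ z → vert (φ z) ≡ vert (α z)
  vert-φ z = σ-vert (α z)

  vert-αα : ∀ z → vert (α (α z)) ≡ vert z
  vert-αα z = cong vert (α-invol z)

  φα≡σ : ∀ z → φ (α z) ≡ σ z
  φα≡σ z = cong σ (α-invol z)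

  α-injective : ∀ {x y} → α x ≡ α y → x ≡ y
  α-injective {x} {y} eq = trans (sym (α-invol x)) (trans (cong α eq) (α-invol y))

  φ-injective : ∀ {x y} → φ x ≡ φ y → x ≡ y
  φ-injective = α-injective ∘ σ-inj

  isAt : Fin V → Fin D → ℕ
  isAt w x = if ⌊ vert x ≟ w ⌋ then 1 else 0

  degIn : Fin V → List (Fin D) → ℕ
  degIn w xs = sum (map (isAt w) xs)

  isAt-≡ : ∀ {w e} → vert e ≡ w → isAt w e ≡ 1
  isAt-≡ {w} {e} at with vert e ≟ w
  ... | yes _ = refl
  ... | no ¬at = ⊥-elim (¬at at)

  degIn-─ : ∀ w {e xs} (m : e ∈ xs) → degIn w xs ≡ isAt w e + degIn w (xs ─ m)
  degIn-─ w (here refl) = refl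
  degIn-─ w {e} (there {x = h} m) =
    trans (cong (isAt w h +_) (degIn-─ w m)) (x∙yz≈y∙xz +-commutativeSemigroup (isAt w h) (isAt w e) _)

  EdgeIn : List (Fin D) → Fin V → Fin V → Set
  EdgeIn xs w n = ∃ λ e → e ∈ xs × vert e ≡ w × vert (α e) ≡ n

  neighbours≤degIn : ∀ {w xs ns} → AllPairs _≢_ ns → All (EdgeIn xs w) ns → length ns ≤ degIn w xs
  neighbours≤degIn [] [] = z≤n
  neighbours≤degIn {w} {xs} {n ∷ _} (n≢ns ∷ distinct) ((e , m , at , to) ∷ edges) =
    subst (suc _ ≤_) (sym count) (s≤s (neighbours≤degIn distinct (drop n≢ns edges)))
    where
    count : degIn w xs ≡ suc (degIn w (xs ─ m))
    count = trans (degIn-─ w m) (cong (_+ degIn w (xs ─ m)) (isAt-≡ at))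
    drop : ∀ {ns} → All (n ≢_) ns → All (EdgeIn xs w) ns → All (EdgeIn (xs ─ m) w) ns
    drop [] [] = []
    drop (n≢n′ ∷ n≢ns) ((e′ , m′ , at′ , to′) ∷ edges) =
      (e′ , ∈-─⁺ m′ (λ { refl → n≢n′ (trans (sym to) to′) }) m , at′ , to′) ∷ drop n≢ns edges

  neighbours≤deg : ∀ {w ns} → AllPairs _≢_ ns → All (Adj w) ns → length ns ≤ deg w
  neighbours≤deg distinct adj =
    neighbours≤degIn distinct (All.map (λ { (e , at , to) → e , ∈-allFin e , at , to }) adj)

  three-neighbours⇒deg≢2 : ∀ {w p q r} → p ≢ q → p ≢ r → q ≢ r →
    Adj w p → Adj w q → Adj w r → deg w ≢ 2
  three-neighbours⇒deg≢2 p≢q p≢r q≢r wp wq wr deg≡2 =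
    1+n≰n (subst (3 ≤_) deg≡2
      (neighbours≤deg ((p≢q ∷ p≢r ∷ []) ∷ (q≢r ∷ []) ∷ [] ∷ []) (wp ∷ wq ∷ wr ∷ [])))

  four-neighbours⇒deg≢3 : ∀ {w p q r s} → p ≢ q → p ≢ r → p ≢ s → q ≢ r → q ≢ s → r ≢ s →
    Adj w p → Adj w q → Adj w r → Adj w s → deg w ≢ 3
  four-neighbours⇒deg≢3 p≢q p≢r p≢s q≢r q≢s r≢s wp wq wr ws deg≡3 =
    1+n≰n (subst (4 ≤_) deg≡3
      (neighbours≤deg ((p≢q ∷ p≢r ∷ p≢s ∷ []) ∷ (q≢r ∷ q≢s ∷ []) ∷ (r≢s ∷ []) ∷ [] ∷ [])
                      (wp ∷ wq ∷ wr ∷ ws ∷ [])))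

  targets-≢ : ∀ {w e e′} → vert e ≡ w → vert e′ ≡ w → e ≢ e′ → vert (α e) ≢ vert (α e′)
  targets-≢ at at′ e≢e′ same = e≢e′ (no-multi _ _ (trans at (sym at′)) same)

  deg2-darts : ∀ {w e₁ e₂ e} → deg w ≡ 2 → vert e₁ ≡ w → vert e₂ ≡ w →
    vert (α e₁) ≢ vert (α e₂) → vert e ≡ w → e ≡ e₁ ⊎ e ≡ e₂
  deg2-darts {e₁ = e₁} {e₂} {e} deg≡2 at₁ at₂ t₁≢t₂ at with e ≟ e₁ | e ≟ e₂
  ... | yes e≡e₁ | _ = inj₁ e≡e₁
  ... | no _ | yes e≡e₂ = inj₂ e≡e₂
  ... | no e≢e₁ | no e≢e₂ =
    ⊥-elim (three-neighbours⇒deg≢2 t₁≢t₂ (targets-≢ at₁ at (≢-sym e≢e₁)) (targets-≢ at₂ at (≢-sym e≢e₂))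
              (e₁ , at₁ , refl) (e₂ , at₂ , refl) (e , at , refl) deg≡2)

  deg3-darts : ∀ {w e₁ e₂ e₃ e} → deg w ≡ 3 → vert e₁ ≡ w → vert e₂ ≡ w → vert e₃ ≡ w →
    vert (α e₁) ≢ vert (α e₂) → vert (α e₁) ≢ vert (α e₃) → vert (α e₂) ≢ vert (α e₃) →
    vert e ≡ w → e ≡ e₁ ⊎ e ≡ e₂ ⊎ e ≡ e₃
  deg3-darts {e₁ = e₁} {e₂} {e₃} {e} deg≡3 at₁ at₂ at₃ t₁≢t₂ t₁≢t₃ t₂≢t₃ at
    with e ≟ e₁ | e ≟ e₂ | e ≟ e₃
  ... | yes e≡e₁ | _ | _ = inj₁ e≡e₁
  ... | no _ | yes e≡e₂ | _ = inj₂ (inj₁ e≡e₂)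
  ... | no _ | no _ | yes e≡e₃ = inj₂ (inj₂ e≡e₃)
  ... | no e≢e₁ | no e≢e₂ | no e≢e₃ =
    ⊥-elim (four-neighbours⇒deg≢3 t₁≢t₂ t₁≢t₃ (targets-≢ at₁ at (≢-sym e≢e₁)) t₂≢t₃
              (targets-≢ at₂ at (≢-sym e≢e₂)) (targets-≢ at₃ at (≢-sym e≢e₃))
              (e₁ , at₁ , refl) (e₂ , at₂ , refl) (e₃ , at₃ , refl) (e , at , refl) deg≡3)

  deg3-neighbours : ∀ {w p q r z} → deg w ≡ 3 → p ≢ q → p ≢ r → q ≢ r →
    Adj w p → Adj w q → Adj w r → Adj w z → z ≡ p ⊎ z ≡ q ⊎ z ≡ r
  deg3-neighbours deg≡3 p≢q p≢r q≢r (e₁ , at₁ , to₁) (e₂ , at₂ , to₂) (e₃ , at₃ , to₃) (e , at , to)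
    with deg3-darts deg≡3 at₁ at₂ at₃ (λ same → p≢q (trans (sym to₁) (trans same to₂)))
           (λ same → p≢r (trans (sym to₁) (trans same to₃))) (λ same → q≢r (trans (sym to₂) (trans same to₃))) at
  ... | inj₁ refl = inj₁ (trans (sym to) to₁)
  ... | inj₂ (inj₁ refl) = inj₂ (inj₁ (trans (sym to) to₂))
  ... | inj₂ (inj₂ refl) = inj₂ (inj₂ (trans (sym to) to₃))

  deg2-σ : ∀ {w e₁ e₂} → deg w ≡ 2 → vert e₁ ≡ w → vert e₂ ≡ w →
    vert (α e₁) ≢ vert (α e₂) → σ e₁ ≡ e₂
  deg2-σ {e₁ = e₁} {e₂} deg≡2 at₁ at₂ t₁≢t₂ with deg2-darts deg≡2 at₁ at₂ t₁≢t₂ (trans (σ-vert e₁) at₁)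
  ... | inj₂ σe₁≡e₂ = σe₁≡e₂
  ... | inj₁ σe₁≡e₁ with σ-trans e₁ e₂ (trans at₁ (sym at₂))
  ... | k , σᵏe₁≡e₂ = ⊥-elim (t₁≢t₂ (cong (vert ∘ α) (trans (sym (iter-fixed σ k σe₁≡e₁)) σᵏe₁≡e₂)))

  SameFace-trans : ∀ {x y z} → SameFace x y → SameFace y z → SameFace x z
  SameFace-trans (k , refl) (l , refl) = l + k , iter-+ φ l k _

  Tri : Fin D → Set
  Tri z = φ (φ (φ z)) ≡ z

  Tri-φ : ∀ {z} → Tri z → Tri (φ z)
  Tri-φ = cong φ

  Tri-φ⁻¹ : ∀ {m z} → φ m ≡ z → Tri z → Tri m
  Tri-φ⁻¹ refl tri = φ-injective tri

  triangle-corner : ∀ {u x} → Tri x → OnTriangle u x →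
    ∃ λ a → vert a ≡ u × Tri a × SameFace x a × SameFace a x
  triangle-corner tri (inj₁ at) = _ , at , tri , (0 , refl) , (0 , refl)
  triangle-corner tri (inj₂ (inj₁ at)) = _ , at , Tri-φ tri , (1 , refl) , (2 , tri)
  triangle-corner tri (inj₂ (inj₂ at)) = _ , at , Tri-φ (Tri-φ tri) , (2 , refl) , (1 , tri)

  Cyc : Fin D → Fin D → Fin D → Set
  Cyc p q r = φ p ≡ q × φ q ≡ r × φ r ≡ p

  OnCycle : Fin D → Fin D → Fin D → Fin D → Set
  OnCycle p q r z = z ≡ p ⊎ z ≡ q ⊎ z ≡ r

  cycle-from-first : ∀ {p q r z} → Cyc p q r → OnCycle p q r z → SameFace p z
  cycle-from-first _ (inj₁ refl) = 0 , refl
  cycle-from-first (pq , _ , _) (inj₂ (inj₁ refl)) = 1 , pq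
  cycle-from-first (pq , qr , _) (inj₂ (inj₂ refl)) = 2 , trans (cong φ pq) qr

  Cyc-rotate : ∀ {p q r} → Cyc p q r → Cyc q r p
  Cyc-rotate (pq , qr , rp) = qr , rp , pq

  OnCycle-rotate : ∀ {p q r z} → OnCycle p q r z → OnCycle q r p z
  OnCycle-rotate (inj₁ z≡p) = inj₂ (inj₂ z≡p)
  OnCycle-rotate (inj₂ (inj₁ z≡q)) = inj₁ z≡q
  OnCycle-rotate (inj₂ (inj₂ z≡r)) = inj₂ (inj₁ z≡r)

  cycle-SameFace : ∀ {p q r z z′} → Cyc p q r → OnCycle p q r z → OnCycle p q r z′ → SameFace z z′
  cycle-SameFace cyc (inj₁ refl) on′ = cycle-from-first cyc on′
  cycle-SameFace cyc (inj₂ (inj₁ refl)) on′ = cycle-from-first (Cyc-rotate cyc) (OnCycle-rotate on′)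
  cycle-SameFace cyc (inj₂ (inj₂ refl)) on′ =
    cycle-from-first (Cyc-rotate (Cyc-rotate cyc)) (OnCycle-rotate (OnCycle-rotate on′))

  module _ {p : Fin D} (tri : Tri p) (deg≡2 : deg (vert p) ≡ 2) where
    private
      αr-at-p : vert (α (φ (φ p))) ≡ vert p
      αr-at-p = trans (sym (vert-φ (φ (φ p)))) (cong vert tri)

      targets : vert (α p) ≢ vert (α (α (φ (φ p))))
      targets same = no-loop (φ p)
        (sym (trans (vert-φ p) (trans same (trans (vert-αα _) (vert-φ (φ p))))))

    deg2-corner-darts : ∀ {d} → vert d ≡ vert p → d ≡ p ⊎ d ≡ α (φ (φ p))
    deg2-corner-darts = deg2-darts deg≡2 refl αr-at-p targets

    deg2-corner-σ : σ p ≡ α (φ (φ p))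
    deg2-corner-σ = deg2-σ deg≡2 refl αr-at-p targets

  -- The σ-hypotheses say that every corner of the triangle p q r has only its two triangle edges.
  closed-triangle-covers : Connected → ∀ {p q r} → Cyc p q r →
    σ p ≡ α r → σ q ≡ α p → σ r ≡ α q → ∀ z → OnCycle p q r z ⊎ OnCycle (α q) (α p) (α r) z
  closed-triangle-covers connected {p} {q} {r} (pq , qr , rp) σp σq σr z =
    darts-at (reach (connected (vert p) (vert z)) (inj₁ refl)) refl
    where
    Darts : Fin D → Set
    Darts z = OnCycle p q r z ⊎ OnCycle (α q) (α p) (α r) z

    Corners : Fin V → Set
    Corners w = w ≡ vert p ⊎ w ≡ vert q ⊎ w ≡ vert r

    σ-closed : ∀ {z} → Darts z → Darts (σ z)
    σ-closed (inj₁ (inj₁ refl)) = inj₂ (inj₂ (inj₂ σp))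
    σ-closed (inj₁ (inj₂ (inj₁ refl))) = inj₂ (inj₂ (inj₁ σq))
    σ-closed (inj₁ (inj₂ (inj₂ refl))) = inj₂ (inj₁ σr)
    σ-closed (inj₂ (inj₁ refl)) = inj₁ (inj₂ (inj₂ qr))
    σ-closed (inj₂ (inj₂ (inj₁ refl))) = inj₁ (inj₂ (inj₁ pq))
    σ-closed (inj₂ (inj₂ (inj₂ refl))) = inj₁ (inj₁ rp)

    α-closed : ∀ {z} → Darts z → Darts (α z)
    α-closed (inj₁ (inj₁ refl)) = inj₂ (inj₂ (inj₁ refl))
    α-closed (inj₁ (inj₂ (inj₁ refl))) = inj₂ (inj₁ refl)
    α-closed (inj₁ (inj₂ (inj₂ refl))) = inj₂ (inj₂ (inj₂ refl))
    α-closed (inj₂ (inj₁ refl)) = inj₁ (inj₂ (inj₁ (α-invol q)))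
    α-closed (inj₂ (inj₂ (inj₁ refl))) = inj₁ (inj₁ (α-invol p))
    α-closed (inj₂ (inj₂ (inj₂ refl))) = inj₁ (inj₂ (inj₂ (α-invol r)))

    target : ∀ {x y} → φ x ≡ y → vert (α x) ≡ vert y
    target {x} φx≡y = trans (sym (vert-φ x)) (cong vert φx≡y)

    corner-of : ∀ {z} → Darts z → Corners (vert z)
    corner-of (inj₁ (inj₁ refl)) = inj₁ refl
    corner-of (inj₁ (inj₂ (inj₁ refl))) = inj₂ (inj₁ refl)
    corner-of (inj₁ (inj₂ (inj₂ refl))) = inj₂ (inj₂ refl)
    corner-of (inj₂ (inj₁ refl)) = inj₂ (inj₂ (target qr))
    corner-of (inj₂ (inj₂ (inj₁ refl))) = inj₂ (inj₁ (target pq))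
    corner-of (inj₂ (inj₂ (inj₂ refl))) = inj₁ (target rp)

    rotation-closed : ∀ {x} k → Darts x → Darts (iter σ k x)
    rotation-closed zero dx = dx
    rotation-closed (suc k) dx = σ-closed (rotation-closed k dx)

    from : ∀ {x z} → Darts x → vert z ≡ vert x → Darts z
    from {x} {z} dx same with σ-trans x z (sym same)
    ... | k , σᵏx≡z = subst Darts σᵏx≡z (rotation-closed k dx)

    darts-at : ∀ {w z} → Corners w → vert z ≡ w → Darts z
    darts-at (inj₁ refl) at = from (inj₁ (inj₁ refl)) at
    darts-at (inj₂ (inj₁ refl)) at = from (inj₁ (inj₂ (inj₁ refl))) at
    darts-at (inj₂ (inj₂ refl)) at = from (inj₁ (inj₂ (inj₂ refl))) at

    reach : ∀ {w w′} → Star Adj w w′ → Corners w → Corners w′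
    reach ε cw = cw
    reach ((e , at , refl) ◅ path) cw = reach path (corner-of (α-closed (darts-at cw at)))

  deg2-edge-triangle-SameFace : Connected → ∀ {p d} → Tri p → deg (vert p) ≡ 2 → deg (vert (φ p)) ≡ 2 →
    Tri d → vert d ≡ vert p ⊎ vert d ≡ vert (φ p) →
    ¬ SameFace outer p → ¬ SameFace outer d → SameFace p d
  deg2-edge-triangle-SameFace connected {p} {d} tri deg-p deg-q tri-d at outer≁p outer≁d = dart-cases at
    where
    q r : Fin D
    q = φ p
    r = φ q

    σp : σ p ≡ α r
    σp = deg2-corner-σ tri deg-p

    σq : σ q ≡ α p
    σq = subst (λ t → σ q ≡ α t) tri (deg2-corner-σ (Tri-φ tri) deg-q)

    φαp : φ (α p) ≡ α r
    φαp = trans (φα≡σ p) σp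

    φαq : φ (α q) ≡ α p
    φαq = trans (φα≡σ q) σq

    σr : Tri (α p) → σ r ≡ α q
    σr tri-αp = φ-injective (trans (subst (λ t → φ t ≡ α p) (φα≡σ r)
                                      (subst (λ t → φ (φ t) ≡ α p) φαp tri-αp))
                                   (sym φαq))

    reverse-face : Tri (α p) → OnCycle (α q) (α p) (α r) d → ⊥
    reverse-face tri-αp d-on
      with closed-triangle-covers connected (refl , refl , tri) σp σq (σr tri-αp) outer
    ... | inj₁ outer-on = outer≁p (cycle-SameFace (refl , refl , tri) outer-on (inj₁ refl))
    ... | inj₂ outer-on =
      outer≁d (cycle-SameFace (φαq , φαp , trans (φα≡σ r) (σr tri-αp)) outer-on d-on)

    dart-cases : vert d ≡ vert p ⊎ vert d ≡ vert q → SameFace p d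
    dart-cases (inj₁ at-p) with deg2-corner-darts tri deg-p at-p
    ... | inj₁ d≡p = 0 , sym d≡p
    ... | inj₂ d≡αr =
      ⊥-elim (reverse-face (Tri-φ⁻¹ φαp (subst Tri d≡αr tri-d)) (inj₂ (inj₂ d≡αr)))
    dart-cases (inj₂ at-q) with deg2-corner-darts (Tri-φ tri) deg-q at-q
    ... | inj₁ d≡q = 1 , sym d≡q
    ... | inj₂ d≡αφ³p = ⊥-elim (reverse-face (subst Tri d≡αp tri-d) (inj₂ (inj₁ d≡αp)))
      where
      d≡αp : d ≡ α p
      d≡αp = trans d≡αφ³p (cong α tri)

  deg2-triangles-nonadjacent : Connected → ∀ {u v x y} →
    FacialTriangle x → FacialTriangle y → OnTriangle u x → OnTriangle v y →
    deg u ≡ 2 → deg v ≡ 2 → ¬ SameFace x y → ¬ Adj u v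
  deg2-triangles-nonadjacent connected {x = x} (x-bdd , tri-x , _) (y-bdd , tri-y , _) u∈x v∈y
    deg-u deg-v x≁y (e , e-at , e-to)
    with triangle-corner tri-x u∈x | triangle-corner tri-y v∈y
  ... | a , refl , tri-a , x→a , a→x | d , refl , tri-d , _ , d→y =
    edge-cases (deg2-corner-darts tri-a deg-u e-at)
    where
    via : ∀ {p} → Tri p → SameFace x p → SameFace p x →
      deg (vert p) ≡ 2 → deg (vert (φ p)) ≡ 2 → vert d ≡ vert p ⊎ vert d ≡ vert (φ p) → ⊥
    via {p} tri-p x→p p→x deg-p deg-q at = x≁y (SameFace-trans x→p (SameFace-trans p→d d→y))
      where
      p→d : SameFace p d
      p→d = deg2-edge-triangle-SameFace connected tri-p deg-p deg-q tri-d at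
              (λ outer→p → x-bdd (SameFace-trans outer→p p→x))
              (λ outer→d → y-bdd (SameFace-trans outer→d d→y))

    edge-cases : e ≡ a ⊎ e ≡ α (φ (φ a)) → ⊥
    edge-cases (inj₁ e≡a) = via tri-a x→a a→x deg-u (subst (λ w → deg w ≡ 2) at-φa deg-v) (inj₂ at-φa)
      where
      at-φa : vert d ≡ vert (φ a)
      at-φa = sym (trans (vert-φ a) (trans (cong (vert ∘ α) (sym e≡a)) e-to))
    edge-cases (inj₂ e≡αc) =
      via (Tri-φ (Tri-φ tri-a)) (SameFace-trans x→a (2 , refl)) (SameFace-trans (1 , tri-a) a→x)
          (subst (λ w → deg w ≡ 2) at-c deg-v) (subst (λ t → deg (vert t) ≡ 2) (sym tri-a) deg-u)
          (inj₁ at-c)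
      where
      at-c : vert d ≡ vert (φ (φ a))
      at-c = sym (trans (sym (vert-αα _)) (trans (cong (vert ∘ α) (sym e≡αc)) e-to))

  pattern hub₁ e = inj₁ e
  pattern hub₂ e = inj₂ (inj₁ e)
  pattern hub₃ e = inj₂ (inj₂ (inj₁ e))
  pattern hub₄ e = inj₂ (inj₂ (inj₂ (inj₁ e)))
  pattern rim₁₂ e = inj₂ (inj₂ (inj₂ (inj₂ (inj₁ e))))
  pattern rim₂₃ e = inj₂ (inj₂ (inj₂ (inj₂ (inj₂ (inj₁ e)))))
  pattern rim₃₄ e = inj₂ (inj₂ (inj₂ (inj₂ (inj₂ (inj₂ (inj₁ e))))))
  pattern rim₄₁ e = inj₂ (inj₂ (inj₂ (inj₂ (inj₂ (inj₂ (inj₂ e))))))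

  SameEdges : Wheel → Wheel → Set
  SameEdges w w′ = ∀ x y → (WEdge w x y → WEdge w′ x y) × (WEdge w′ x y → WEdge w x y)

  SameEdges-refl : ∀ {w} → SameEdges w w
  SameEdges-refl x y = (λ e → e) , (λ e → e)

  SameEdges-sym : ∀ {w w′} → SameEdges w w′ → SameEdges w′ w
  SameEdges-sym same x y = swap (same x y)

  SameEdges-trans : ∀ {w w′ w″} → SameEdges w w′ → SameEdges w′ w″ → SameEdges w w″
  SameEdges-trans s t x y = proj₁ (t x y) ∘ proj₁ (s x y) , proj₂ (s x y) ∘ proj₂ (t x y)

  rotate reflect : Wheel → Wheel
  rotate (wheel c a1 a2 a3 a4) = wheel c a2 a3 a4 a1
  reflect (wheel c a1 a2 a3 a4) = wheel c a1 a4 a3 a2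

  rotate-edges : ∀ w x y → WEdge₀ w x y → WEdge₀ (rotate w) x y
  rotate-edges w x y (hub₁ e) = hub₄ e
  rotate-edges w x y (hub₂ e) = hub₁ e
  rotate-edges w x y (hub₃ e) = hub₂ e
  rotate-edges w x y (hub₄ e) = hub₃ e
  rotate-edges w x y (rim₁₂ e) = rim₄₁ e
  rotate-edges w x y (rim₂₃ e) = rim₁₂ e
  rotate-edges w x y (rim₃₄ e) = rim₂₃ e
  rotate-edges w x y (rim₄₁ e) = rim₃₄ e

  -- rotate has order 4 definitionally (Wheel has eta), so three more rotations undo one.
  rotate-edges⁻¹ : ∀ w x y → WEdge₀ (rotate w) x y → WEdge₀ w x y
  rotate-edges⁻¹ w x y =
    rotate-edges (rotate (rotate (rotate w))) x y ∘ rotate-edges (rotate (rotate w)) x y ∘ rotate-edges (rotate w) x y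

  reflect-edges : ∀ w x y → WEdge₀ w x y → WEdge (reflect w) x y
  reflect-edges w x y (hub₁ e) = inj₁ (hub₁ e)
  reflect-edges w x y (hub₂ e) = inj₁ (hub₄ e)
  reflect-edges w x y (hub₃ e) = inj₁ (hub₃ e)
  reflect-edges w x y (hub₄ e) = inj₁ (hub₂ e)
  reflect-edges w x y (rim₁₂ e) = inj₂ (rim₄₁ (swap e))
  reflect-edges w x y (rim₂₃ e) = inj₂ (rim₃₄ (swap e))
  reflect-edges w x y (rim₃₄ e) = inj₂ (rim₂₃ (swap e))
  reflect-edges w x y (rim₄₁ e) = inj₂ (rim₁₂ (swap e))

  symmetrize : ∀ {w w′} → (∀ x y → WEdge₀ w x y → WEdge w′ x y) → ∀ x y → WEdge w x y → WEdge w′ x y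
  symmetrize f x y (inj₁ e) = f x y e
  symmetrize f x y (inj₂ e) = Sum.swap (f y x e)

  rotate-SameEdges : ∀ w → SameEdges w (rotate w)
  rotate-SameEdges w x y =
    symmetrize (λ x y → inj₁ ∘ rotate-edges w x y) x y , symmetrize (λ x y → inj₁ ∘ rotate-edges⁻¹ w x y) x y

  reflect-SameEdges : ∀ w → SameEdges w (reflect w)
  reflect-SameEdges w x y = symmetrize (reflect-edges w) x y , symmetrize (reflect-edges (reflect w)) x y

  WEdge⇒Adj : ∀ {w} → IsWheel w → ∀ {x y} → WEdge w x y → Adj x y
  WEdge⇒Adj (_ , edges) (inj₁ e) = edges _ _ e
  WEdge⇒Adj (_ , edges) (inj₂ e) = Adj-sym (edges _ _ e)

  rotate-IsWheel : ∀ {w} → IsWheel w → IsWheel (rotate w)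
  rotate-IsWheel {w} ((c≢a1 , c≢a2 , c≢a3 , c≢a4 , a1≢a2 , a1≢a3 , a1≢a4 , a2≢a3 , a2≢a4 , a3≢a4) , edges) =
    (c≢a2 , c≢a3 , c≢a4 , c≢a1 , a2≢a3 , a2≢a4 , ≢-sym a1≢a2 , a3≢a4 , ≢-sym a1≢a3 , ≢-sym a1≢a4) ,
    (λ x y → edges x y ∘ rotate-edges⁻¹ w x y)

  reflect-IsWheel : ∀ {w} → IsWheel w → IsWheel (reflect w)
  reflect-IsWheel {w} iw@((c≢a1 , c≢a2 , c≢a3 , c≢a4 , a1≢a2 , a1≢a3 , a1≢a4 , a2≢a3 , a2≢a4 , a3≢a4) , _) =
    (c≢a1 , c≢a4 , c≢a3 , c≢a2 , a1≢a4 , a1≢a3 , a1≢a2 , ≢-sym a3≢a4 , ≢-sym a2≢a4 , ≢-sym a2≢a3) ,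
    (λ x y → WEdge⇒Adj iw ∘ reflect-edges (reflect w) x y)

  module WheelAdj {c a1 a2 a3 a4} (iw : IsWheel (wheel c a1 a2 a3 a4)) where
    c-a1 : Adj c a1
    c-a1 = proj₂ iw _ _ (hub₁ (refl , refl))
    c-a2 : Adj c a2
    c-a2 = proj₂ iw _ _ (hub₂ (refl , refl))
    c-a3 : Adj c a3
    c-a3 = proj₂ iw _ _ (hub₃ (refl , refl))
    c-a4 : Adj c a4
    c-a4 = proj₂ iw _ _ (hub₄ (refl , refl))
    a1-a2 : Adj a1 a2
    a1-a2 = proj₂ iw _ _ (rim₁₂ (refl , refl))
    a2-a3 : Adj a2 a3
    a2-a3 = proj₂ iw _ _ (rim₂₃ (refl , refl))
    a3-a4 : Adj a3 a4
    a3-a4 = proj₂ iw _ _ (rim₃₄ (refl , refl))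
    a4-a1 : Adj a4 a1
    a4-a1 = proj₂ iw _ _ (rim₄₁ (refl , refl))

  rim-deg3-neighbours : ∀ {c a1 a2 a3 a4 z} → IsWheel (wheel c a1 a2 a3 a4) → deg a1 ≡ 3 →
    Adj a1 z → z ≡ c ⊎ z ≡ a2 ⊎ z ≡ a4
  rim-deg3-neighbours iw@((_ , c≢a2 , _ , c≢a4 , _ , _ , _ , _ , a2≢a4 , _) , _) deg≡3 =
    deg3-neighbours deg≡3 c≢a2 c≢a4 a2≢a4 (Adj-sym c-a1) a1-a2 (Adj-sym a4-a1)
    where open WheelAdj iw

  hub-deg≢3 : ∀ {c a1 a2 a3 a4} → IsWheel (wheel c a1 a2 a3 a4) → deg c ≢ 3
  hub-deg≢3 iw@((_ , _ , _ , _ , a1≢a2 , a1≢a3 , a1≢a4 , a2≢a3 , a2≢a4 , a3≢a4) , _) =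
    four-neighbours⇒deg≢3 a1≢a2 a1≢a3 a1≢a4 a2≢a3 a2≢a4 a3≢a4 c-a1 c-a2 c-a3 c-a4
    where open WheelAdj iw

  rim-deg3-deg2-nonadjacent : ∀ {c a1 a2 a3 a4 u} → IsWheel (wheel c a1 a2 a3 a4) →
    deg a1 ≡ 3 → deg u ≡ 2 → ¬ Adj a1 u
  rim-deg3-deg2-nonadjacent {c} {a1} {a2} {a3} {a4} {u}
    iw@((c≢a1 , _ , c≢a3 , _ , a1≢a2 , a1≢a3 , _ , a2≢a3 , _ , _) , _) deg-a1 deg-u adj =
    neighbour-cases (rim-deg3-neighbours iw deg-a1 adj)
    where
    open WheelAdj iw
    neighbour-cases : u ≡ c ⊎ u ≡ a2 ⊎ u ≡ a4 → ⊥
    neighbour-cases (inj₁ refl) = three-neighbours⇒deg≢2 a1≢a2 a1≢a3 a2≢a3 c-a1 c-a2 c-a3 deg-u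
    neighbour-cases (inj₂ (inj₁ refl)) =
      three-neighbours⇒deg≢2 c≢a1 c≢a3 a1≢a3 (Adj-sym c-a2) (Adj-sym a1-a2) a2-a3 deg-u
    neighbour-cases (inj₂ (inj₂ refl)) =
      three-neighbours⇒deg≢2 c≢a3 c≢a1 (≢-sym a1≢a3) (Adj-sym c-a4) (Adj-sym a3-a4) a4-a1 deg-u

  consecutive-deg3-rims : ∀ {c a1 a2 a3 a4 d b2 b3 b4} →
    IsWheel (wheel c a1 a2 a3 a4) → IsWheel (wheel d a2 b2 b3 b4) → deg a1 ≡ 3 → deg a2 ≡ 3 →
    SameEdges (wheel c a1 a2 a3 a4) (wheel d a2 b2 b3 b4)
  consecutive-deg3-rims {c} {a1} {a2} {a3} {a4} {d} {b2} {b3} {b4}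
    iw@((_ , _ , c≢a3 , _ , _ , _ , _ , a2≢a3 , _ , a3≢a4) , _)
    iw′@((d≢a2 , d≢b2 , d≢b3 , d≢b4 , a2≢b2 , a2≢b3 , _ , _ , b2≢b4 , _) , _) deg-a1 deg-a2 =
    hub-cases (N₂ (Adj-sym W′.c-a1))
    where
    module W′ = WheelAdj iw′

    N₁ : ∀ {z} → Adj a1 z → z ≡ c ⊎ z ≡ a2 ⊎ z ≡ a4
    N₁ = rim-deg3-neighbours iw deg-a1

    N₂ : ∀ {z} → Adj a2 z → z ≡ c ⊎ z ≡ a3 ⊎ z ≡ a1
    N₂ = rim-deg3-neighbours (rotate-IsWheel iw) deg-a2

    a1≁a3 : ¬ Adj a1 a3
    a1≁a3 adj with N₁ adj
    ... | inj₁ a3≡c = c≢a3 (sym a3≡c)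
    ... | inj₂ (inj₁ a3≡a2) = a2≢a3 (sym a3≡a2)
    ... | inj₂ (inj₂ a3≡a4) = a3≢a4 a3≡a4

    hub-a3 : d ≡ a3 → ⊥
    hub-a3 refl with N₂ W′.a1-a2
    ... | inj₂ (inj₁ refl) = d≢b2 refl
    ... | inj₂ (inj₂ refl) = a1≁a3 (Adj-sym W′.c-a2)
    ... | inj₁ refl with N₂ (Adj-sym W′.a4-a1)
    ...   | inj₁ refl = b2≢b4 refl
    ...   | inj₂ (inj₁ refl) = d≢b4 refl
    ...   | inj₂ (inj₂ refl) = a1≁a3 (Adj-sym W′.c-a4)

    hub-c : d ≡ c → SameEdges (wheel c a1 a2 a3 a4) (wheel d a2 b2 b3 b4)
    hub-c refl with N₂ W′.a1-a2 | N₂ (Adj-sym W′.a4-a1)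
    ... | inj₁ refl | _ = ⊥-elim (d≢b2 refl)
    ... | _ | inj₁ refl = ⊥-elim (d≢b4 refl)
    ... | inj₂ (inj₁ refl) | inj₂ (inj₁ refl) = ⊥-elim (b2≢b4 refl)
    ... | inj₂ (inj₂ refl) | inj₂ (inj₂ refl) = ⊥-elim (b2≢b4 refl)
    ... | inj₂ (inj₁ refl) | inj₂ (inj₂ refl) with N₁ (Adj-sym W′.a3-a4)
    ...   | inj₁ refl = ⊥-elim (d≢b3 refl)
    ...   | inj₂ (inj₁ refl) = ⊥-elim (a2≢b3 refl)
    ...   | inj₂ (inj₂ refl) = rotate-SameEdges _
    hub-c refl | inj₂ (inj₂ refl) | inj₂ (inj₁ refl) with N₁ W′.a2-a3
    ...   | inj₁ refl = ⊥-elim (d≢b3 refl)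
    ...   | inj₂ (inj₁ refl) = ⊥-elim (a2≢b3 refl)
    ...   | inj₂ (inj₂ refl) = SameEdges-trans (rotate-SameEdges _) (reflect-SameEdges _)

    hub-cases : d ≡ c ⊎ d ≡ a3 ⊎ d ≡ a1 → SameEdges (wheel c a1 a2 a3 a4) (wheel d a2 b2 b3 b4)
    hub-cases (inj₁ d≡c) = hub-c d≡c
    hub-cases (inj₂ (inj₁ d≡a3)) = ⊥-elim (hub-a3 d≡a3)
    hub-cases (inj₂ (inj₂ refl)) = ⊥-elim (hub-deg≢3 iw′ deg-a1)

  adjacent-deg3-rims : ∀ {c a1 a2 a3 a4 d b1 b2 b3 b4} →
    IsWheel (wheel c a1 a2 a3 a4) → IsWheel (wheel d b1 b2 b3 b4) → deg a1 ≡ 3 → deg b1 ≡ 3 →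
    Adj a1 b1 → SameEdges (wheel c a1 a2 a3 a4) (wheel d b1 b2 b3 b4)
  adjacent-deg3-rims iw iw′ deg-a1 deg-b1 adj with rim-deg3-neighbours iw deg-a1 adj
  ... | inj₁ refl = ⊥-elim (hub-deg≢3 iw deg-b1)
  ... | inj₂ (inj₁ refl) = consecutive-deg3-rims iw iw′ deg-a1 deg-b1
  ... | inj₂ (inj₂ refl) =
    SameEdges-trans (reflect-SameEdges _) (consecutive-deg3-rims (reflect-IsWheel iw) iw′ deg-a1 deg-b1)

  AtFront : Fin V → Wheel → Set
  AtFront u w = ∃ λ w′ → IsWheel w′ × SameEdges w w′ × Wheel.a1 w′ ≡ u

  rotated-to-front : ∀ k {w u} → IsWheel w → Wheel.a1 (iter rotate k w) ≡ u → AtFront u w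
  rotated-to-front k {w} iw front = iter rotate k w , rotated-IsWheel k , rotated-SameEdges k , front
    where
    rotated-IsWheel : ∀ k → IsWheel (iter rotate k w)
    rotated-IsWheel zero = iw
    rotated-IsWheel (suc k) = rotate-IsWheel (rotated-IsWheel k)
    rotated-SameEdges : ∀ k → SameEdges w (iter rotate k w)
    rotated-SameEdges zero = SameEdges-refl
    rotated-SameEdges (suc k) = SameEdges-trans (rotated-SameEdges k) (rotate-SameEdges _)

  three-pair-at-front : ∀ {w u} → IsWheel w → InThreePair u w → deg u ≡ 3 × AtFront u w
  three-pair-at-front iw (inj₁ ((_ , d₁ , _ , _) , inj₁ refl)) = d₁ , rotated-to-front 0 iw refl
  three-pair-at-front iw (inj₁ ((_ , _ , _ , d₂) , inj₂ refl)) = d₂ , rotated-to-front 1 iw refl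
  three-pair-at-front iw (inj₂ (inj₁ ((_ , d₂ , _ , _) , inj₁ refl))) = d₂ , rotated-to-front 1 iw refl
  three-pair-at-front iw (inj₂ (inj₁ ((_ , _ , _ , d₃) , inj₂ refl))) = d₃ , rotated-to-front 2 iw refl
  three-pair-at-front iw (inj₂ (inj₂ (inj₁ ((_ , d₃ , _ , _) , inj₁ refl)))) = d₃ , rotated-to-front 2 iw refl
  three-pair-at-front iw (inj₂ (inj₂ (inj₁ ((_ , _ , _ , d₄) , inj₂ refl)))) = d₄ , rotated-to-front 3 iw refl
  three-pair-at-front iw (inj₂ (inj₂ (inj₂ ((_ , d₄ , _ , _) , inj₁ refl)))) = d₄ , rotated-to-front 3 iw refl
  three-pair-at-front iw (inj₂ (inj₂ (inj₂ ((_ , _ , _ , d₁) , inj₂ refl)))) = d₁ , rotated-to-front 0 iw refl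

  three-pair-deg2-nonadjacent : ∀ {w u v} → IsWheel w → InThreePair u w → deg v ≡ 2 → ¬ Adj u v
  three-pair-deg2-nonadjacent iw u∈w deg-v with three-pair-at-front iw u∈w
  ... | deg-u , _ , iw′ , _ , refl = rim-deg3-deg2-nonadjacent iw′ deg-u deg-v

  adjacent-three-pairs-SameEdges : ∀ {w w′ u v} → IsWheel w → IsWheel w′ →
    InThreePair u w → InThreePair v w′ → Adj u v → SameEdges w w′
  adjacent-three-pairs-SameEdges iw iw′ u∈w v∈w′ adj
    with three-pair-at-front iw u∈w | three-pair-at-front iw′ v∈w′
  ... | deg-u , _ , iw₀ , w≈w₀ , refl | deg-v , _ , iw₀′ , w′≈w₀′ , refl =
    SameEdges-trans w≈w₀ (SameEdges-trans (adjacent-deg3-rims iw₀ iw₀′ deg-u deg-v adj) (SameEdges-sym w′≈w₀′))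

  facial : ∀ {x} → Ear x ⊎ Pivoting x ⊎ Isolated x → FacialTriangle x
  facial = Sum.[ proj₁ , Sum.[ proj₁ , proj₁ ] ]

lemma8 : (G : PlaneGraph) → PlaneGraph.Skeletal G →
    ∀ u v (p q : PlaneGraph.Problem G) →
    PlaneGraph.InvolvedIn G u p → PlaneGraph.InvolvedIn G v q →
    ¬ PlaneGraph.SameProblem G p q →
    ¬ PlaneGraph.Adj G u v
lemma8 G (connected , _) _ _ (triangle _) (triangle _) (x-tri , u∈x , deg-u) (y-tri , v∈y , deg-v) x≁y =
  deg2-triangles-nonadjacent G connected (facial G x-tri) (facial G y-tri) u∈x v∈y deg-u deg-v x≁y
lemma8 G _ _ _ (triangle _) (bad5wheel _) (_ , _ , deg-u) (iw , v∈w) _ =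
  three-pair-deg2-nonadjacent G iw v∈w deg-u ∘ Adj-sym G
lemma8 G _ _ _ (bad5wheel _) (triangle _) (iw , u∈w) (_ , _ , deg-v) _ =
  three-pair-deg2-nonadjacent G iw u∈w deg-v
lemma8 G _ _ _ (bad5wheel _) (bad5wheel _) (iw , u∈w) (iw′ , v∈w′) w≉w′ =
  w≉w′ ∘ adjacent-three-pairs-SameEdges G iw iw′ u∈w v∈w′
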